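{- Let $F$ be a clause set. If $F$ is satisfiable, then the reasoning algorithm with inference rules A1, A2, and A3, started from $\mathcal{S}_0=\{F\}$, yields a complete and clash-free family of clause sets (i.e. some sequence of rule applications from $\mathcal{S}_0$ ends in a complete and clash-free family).
   Context: $\mathcal{ALC}$ interpretations $\mathcal{I}=(\Delta^\mathcal{I},\cdot^\mathcal{I})$ with the standard semantics of $\lnot,\sqcap,\sqcup,\forall R.,\exists R.$. Conjunctive normal forms are defined by mutual induction: a concept literal is $A$, $\lnot A$ ($A$ a concept name), $\exists R.F$ or $\forall R.F$ ($R$ a role name, $F$ a conjunctive normal form); a clause is a finite disjunction of concept literals, represented as a set of literals; a conjunctive normal form is a finite conjunction of clauses, represented as a clause set. A clause set $F$ denotes the conjunction of its clauses, each clause the disjunction of its literals; $F$ is satisfiable if $F^\mathcal{I}\neq\emptyset$ for some interpretation $\mathcal{I}$. The complementary literal $\overline{L}$ is: $\overline{A}=\lnot A$, $\overline{\lnot A}=A$, $\overline{\exists R.F}=\forall R.\mathrm{CNF}(\lnot F)$, $\overline{\forall R.F}=\exists R.\mathrm{CNF}(\lnot F)$, with $\mathrm{CNF}(C)$ the equivalent conjunctive normal form of $C$ (push negations inward, distribute $\sqcup$ over $\sqcap$, flatten). A derivation works on families of clause sets $\mathcal{S}_i$, starting with $\mathcal{S}_0=\{F\}$; $\mathcal{S}_{i+1}$ is obtained from $\mathcal{S}_i$ by applying one of the following rules to a clause set $F\in\mathcal{S}_i$: (A1) if $L\in CL$ for a clause $CL\in F$: replace $CL$ by $\{L\}$ (nondeterministic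 choice of $L$). (A2) if $\forall R.F_1\in CL$ for some clause $CL\in F$: remove from $F$ all clauses containing $\forall R.F_1$, and replace every literal $\exists R.F_2$ occurring in clauses of $F$ by $\exists R.(F_1\cup F_2)$. (A3) if all clauses of $F$ are unit clauses of the form $\{A\}$, $\{\lnot A\}$ or $\{\exists R.F'\}$: for some $\{\exists R.F_1\}\in F$, replace $F$ by $F\setminus\{\{\exists R.F_1\}\}$ and add $F_1$ to the family ($F$ is the parent of $F_1$ with respect to $R$). A family is complete if no rule is applicable to it. It is clash-free if no clause set in it contains the empty clause or contains both $\{L\}$ and $\{\overline{L}\}$ for some literal $L$. -}

module Defs where

open import Data.Nat using (ℕ)
open import Data.Nat.Properties using (_≟_)
open import Data.List using (List; []; _∷_; _++_; map; concatMap)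
open import Data.List.Membership.Propositional using (_∈_; _∉_)
open import Data.List.Relation.Unary.All using (All)
open import Data.List.Relation.Unary.Any using (Any)
open import Data.Product using (Σ; _×_; ∃)
open import Data.Sum using (_⊎_)
open import Data.Empty using (⊥)
open import Data.Unit using (⊤)
open import Relation.Nullary using (¬_; yes; no)
open import Relation.Binary.PropositionalEquality using (_≡_; _≢_)
open import Relation.Binary.Construct.Closure.ReflexiveTransitive using (Star)

-- Syntax.  Concept names and role names are natural numbers.
-- Sets (clauses, clause sets, families) are represented by lists.

data Lit : Set where
  pos : ℕ → Lit
  neg : ℕ → Lit
  ex  : ℕ → List (List Lit) → Lit
  all : ℕ → List (List Lit) → Lit

Clause : Set
Clause = List Lit

CNF : Set
CNF = List Clause

Family : Set
Family = List CNF

-- Complementary literal and CNF(¬ F)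
-- ¬ (⋀_i ⋁_j L_ij)  =  ⋁_i ⋀_j ¬L_ij, distributed into CNF:
-- one clause { L̄_{1 j1}, …, L̄_{n jn} } per choice of j_i.

prod : Clause → CNF → CNF
prod c ds = concatMap (λ l → map (l ∷_) ds) c

mutual
  comp : Lit → Lit
  comp (pos A)   = neg A
  comp (neg A)   = pos A
  comp (ex R F)  = all R (negCNF F)
  comp (all R F) = ex R (negCNF F)

  compCl : Clause → Clause
  compCl []      = []
  compCl (L ∷ C) = comp L ∷ compCl C

  negCNF : CNF → CNF
  negCNF []      = [] ∷ []
  negCNF (C ∷ F) = prod (compCl C) (negCNF F)

record Interp : Set₁ where
  field
    Δ    : Set
    conc : ℕ → Δ → Set
    role : ℕ → Δ → Δ → Set

module Sem (I : Interp) where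
  open Interp I
  mutual
    ⟦_⟧L : Lit → Δ → Set
    ⟦ pos A ⟧L d   = conc A d
    ⟦ neg A ⟧L d   = ¬ conc A d
    ⟦ ex R F ⟧L d  = Σ Δ λ e → role R d e × ⟦ F ⟧F e
    ⟦ all R F ⟧L d = (e : Δ) → role R d e → ⟦ F ⟧F e

    ⟦_⟧C : Clause → Δ → Set
    ⟦ [] ⟧C d    = ⊥
    ⟦ L ∷ C ⟧C d = ⟦ L ⟧L d ⊎ ⟦ C ⟧C d

    ⟦_⟧F : CNF → Δ → Set
    ⟦ [] ⟧F d    = ⊤
    ⟦ C ∷ F ⟧F d = ⟦ C ⟧C d × ⟦ F ⟧F d

Satisfiable : CNF → Set₁
Satisfiable F = Σ Interp λ I → Σ (Interp.Δ I) λ d → Sem.⟦_⟧F I F d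

extend : ℕ → CNF → Lit → Lit
extend R F1 (ex R' F2) with R ≟ R'
... | yes _ = ex R' (F1 ++ F2)
... | no  _ = ex R' F2
extend R F1 L = L

data A2R (R : ℕ) (F1 : CNF) : CNF → CNF → Set where
  nil  : A2R R F1 [] []
  drop : ∀ {C F F'} → all R F1 ∈ C → A2R R F1 F F' → A2R R F1 (C ∷ F) F'
  keep : ∀ {C F F'} → all R F1 ∉ C → A2R R F1 F F' →
         A2R R F1 (C ∷ F) (map (extend R F1) C ∷ F')

-- literals allowed in the precondition of A3
data Basic : Lit → Set where
  bpos : ∀ {A} → Basic (pos A)
  bneg : ∀ {A} → Basic (neg A)
  bex  : ∀ {R F} → Basic (ex R F)

AllBasicUnits : CNF → Set
AllBasicUnits F = All (λ C → Σ Lit λ L → C ≡ L ∷ [] × Basic L) F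

-- Rule application to a single clause set: Step1 F F' new means F is
-- replaced by F' and the clause sets in `new` are added to the family.
data Step1 : CNF → CNF → List CNF → Set where
  A1 : (xs ys : CNF) (CL : Clause) (L : Lit) →
       L ∈ CL → CL ≢ L ∷ [] →
       Step1 (xs ++ CL ∷ ys) (xs ++ (L ∷ []) ∷ ys) []
  A2 : (R : ℕ) (F1 F F' : CNF) →
       Any (λ CL → all R F1 ∈ CL) F → A2R R F1 F F' →
       Step1 F F' []
  A3 : (xs ys : CNF) (R : ℕ) (F1 : CNF) →
       AllBasicUnits (xs ++ (ex R F1 ∷ []) ∷ ys) →
       Step1 (xs ++ (ex R F1 ∷ []) ∷ ys) (xs ++ ys) (F1 ∷ [])

data Step : Family → Family → Set where
  step : (xs ys : Family) {F F' : CNF} {new : List CNF} →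
         Step1 F F' new → Step (xs ++ F ∷ ys) (xs ++ F' ∷ ys ++ new)

Derives : Family → Family → Set
Derives = Star Step

Complete : Family → Set
Complete S = ∀ S' → ¬ Step S S'

ClashFree : Family → Set
ClashFree S =
  All (λ F → ([] ∉ F) × (∀ L → (L ∷ []) ∈ F → (comp L ∷ []) ∉ F)) S

{-# OPTIONS --safe #-}
module Submission where

-- Fix a model I and an element d of F^I, and let the model steer every choice.  A1 keeps
-- in each clause a literal true at d.  A2 for a universal literal ∀R.F₁ true at d adds F₁ to
-- every ∃R.F₂ true at d, and the R-successor witnessing ∃R.F₂ satisfies F₁ as well, so all
-- literals stay true at d, while the number of clauses drops.  A3 then spawns, for each
-- ∃R.F₁, a clause set satisfied by the witnessing successor and of strictly smaller depth.
-- Processing the family in rounds of decreasing depth ends with clause sets consisting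
-- only of atomic unit clauses true at a single element: no rule applies to them, and they
-- cannot contain a clash.

open import Defs
open import Data.Nat using (ℕ; zero; suc; _≤_; _<_; _⊔_; z≤n; s≤s)
open import Data.Nat.Properties using (_≟_; ≤-refl; ≤-pred; <-≤-trans; m≤n⇒m≤1+n; ⊔-assoc; ⊔-lub; m⊔n≤o⇒m≤o; m⊔n≤o⇒n≤o)
open import Data.List using (List; []; _∷_; _++_; length)
open import Data.List.Properties using (++-assoc; ++-identityʳ; ∷-dec)
open import Data.List.Relation.Unary.All as All using (All; []; _∷_)
open import Data.List.Relation.Unary.All.Properties using (++⁺; ++⁻ʳ)
open import Data.List.Relation.Unary.Any using (Any; here; there)
open import Data.List.Membership.Propositional using (_∈_; _∉_; find)
open import Data.Product using (Σ; _×_; _,_; proj₁; ∃₂; uncurry)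
open import Data.Sum using (_⊎_; inj₁; inj₂)
open import Data.Empty using (⊥-elim)
open import Function using (_∘_)
open import Relation.Nullary using (¬_; Dec; yes; no)
open import Relation.Nullary.Decidable using (map′; _×-dec_)
open import Relation.Unary using (_∩_)
open import Relation.Binary.PropositionalEquality using (_≡_; refl; sym; trans; cong; cong₂; subst)
open import Relation.Binary.Construct.Closure.ReflexiveTransitive using (ε; _◅_; _◅◅_)

mutual
  _≟L_ : (L L′ : Lit) → Dec (L ≡ L′)
  pos A  ≟L pos B    = map′ (cong pos) (λ { refl → refl }) (A ≟ B)
  neg A  ≟L neg B    = map′ (cong neg) (λ { refl → refl }) (A ≟ B)
  ex R F ≟L ex R′ F′ =
    map′ (uncurry (cong₂ ex)) (λ { refl → refl , refl }) (R ≟ R′ ×-dec F ≟F F′)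
  all R F ≟L all R′ F′ =
    map′ (uncurry (cong₂ all)) (λ { refl → refl , refl }) (R ≟ R′ ×-dec F ≟F F′)
  pos _   ≟L neg _   = no λ ()
  pos _   ≟L ex _ _  = no λ ()
  pos _   ≟L all _ _ = no λ ()
  neg _   ≟L pos _   = no λ ()
  neg _   ≟L ex _ _  = no λ ()
  neg _   ≟L all _ _ = no λ ()
  ex _ _  ≟L pos _   = no λ ()
  ex _ _  ≟L neg _   = no λ ()
  ex _ _  ≟L all _ _ = no λ ()
  all _ _ ≟L pos _   = no λ ()
  all _ _ ≟L neg _   = no λ ()
  all _ _ ≟L ex _ _  = no λ ()

  _≟C_ : (C C′ : Clause) → Dec (C ≡ C′)
  []      ≟C []        = yes refl
  []      ≟C (_ ∷ _)   = no λ ()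
  (_ ∷ _) ≟C []        = no λ ()
  (L ∷ C) ≟C (L′ ∷ C′) = ∷-dec (L ≟L L′) (C ≟C C′)

  _≟F_ : (F F′ : CNF) → Dec (F ≡ F′)
  []      ≟F []        = yes refl
  []      ≟F (_ ∷ _)   = no λ ()
  (_ ∷ _) ≟F []        = no λ ()
  (C ∷ F) ≟F (C′ ∷ F′) = ∷-dec (C ≟C C′) (F ≟F F′)

mutual
  depthL : Lit → ℕ
  depthL (pos _)   = 0
  depthL (neg _)   = 0
  depthL (ex _ F)  = suc (depthF F)
  depthL (all _ F) = suc (depthF F)

  depthC : Clause → ℕ
  depthC []      = 0
  depthC (L ∷ C) = depthL L ⊔ depthC C

  depthF : CNF → ℕ
  depthF []      = 0
  depthF (C ∷ F) = depthC C ⊔ depthF F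

depthF-++ : ∀ F₁ F₂ → depthF (F₁ ++ F₂) ≡ depthF F₁ ⊔ depthF F₂
depthF-++ []       F₂ = refl
depthF-++ (C ∷ F₁) F₂ =
  trans (cong (depthC C ⊔_) (depthF-++ F₁ F₂)) (sym (⊔-assoc (depthC C) (depthF F₁) (depthF F₂)))

depthC≤⇒All : ∀ {n} C → depthC C ≤ n → All (λ L → depthL L ≤ n) C
depthC≤⇒All []      _ = []
depthC≤⇒All (L ∷ C) p =
  m⊔n≤o⇒m≤o (depthL L) (depthC C) p ∷ depthC≤⇒All C (m⊔n≤o⇒n≤o (depthL L) (depthC C) p)

depthF≤⇒All : ∀ {n} F → depthF F ≤ n → All (All (λ L → depthL L ≤ n)) F
depthF≤⇒All []      _ = []
depthF≤⇒All (C ∷ F) p =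
  depthC≤⇒All C (m⊔n≤o⇒m≤o (depthC C) (depthF F) p) ∷
  depthF≤⇒All F (m⊔n≤o⇒n≤o (depthC C) (depthF F) p)

Unit : (Lit → Set) → Clause → Set
Unit P C = Σ Lit λ L → C ≡ L ∷ [] × P L

Unit-map : ∀ {P Q : Lit → Set} → (∀ {L} → P L → Q L) → ∀ {C} → Unit P C → Unit Q C
Unit-map f (L , eq , p) = L , eq , f p

Unit-literal : ∀ {P L} → Unit P (L ∷ []) → P L
Unit-literal (_ , refl , p) = p

data Atomic : Lit → Set where
  apos : ∀ {A} → Atomic (pos A)
  aneg : ∀ {A} → Atomic (neg A)

atomic⇒basic : ∀ {L} → Atomic L → Basic L
atomic⇒basic apos = bpos
atomic⇒basic aneg = bneg

basic⇒atomic⊎existential : ∀ {L} → Basic L → Atomic L ⊎ ∃₂ λ R F → L ≡ ex R F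
basic⇒atomic⊎existential bpos = inj₁ apos
basic⇒atomic⊎existential bneg = inj₁ aneg
basic⇒atomic⊎existential bex  = inj₂ (_ , _ , refl)

basic⊎universal : ∀ L → Basic L ⊎ ∃₂ λ R F → L ≡ all R F
basic⊎universal (pos _)   = inj₁ bpos
basic⊎universal (neg _)   = inj₁ bneg
basic⊎universal (ex _ _)  = inj₁ bex
basic⊎universal (all _ _) = inj₂ (_ , _ , refl)

A2R-length-≤ : ∀ {R F₁ F F′} → A2R R F₁ F F′ → length F′ ≤ length F
A2R-length-≤ nil        = z≤n
A2R-length-≤ (drop _ a) = m≤n⇒m≤1+n (A2R-length-≤ a)
A2R-length-≤ (keep _ a) = s≤s (A2R-length-≤ a)

A2R-length-< : ∀ {R F₁ F F′} → A2R R F₁ F F′ → Any (all R F₁ ∈_) F → length F′ < length F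
A2R-length-< (drop _ a) (here _)    = s≤s (A2R-length-≤ a)
A2R-length-< (keep ∉C _) (here ∈C)  = ⊥-elim (∉C ∈C)
A2R-length-< (drop _ a) (there any) = m≤n⇒m≤1+n (A2R-length-< a any)
A2R-length-< (keep _ a) (there any) = s≤s (A2R-length-< a any)

LocallyDerives : CNF → CNF → List CNF → Set
LocallyDerives F F′ new = ∀ D R → Derives (D ++ F ∷ R) (D ++ F′ ∷ R ++ new)

ld-refl : ∀ {F} → LocallyDerives F F []
ld-refl {F} D R = subst (λ R′ → Derives (D ++ F ∷ R) (D ++ F ∷ R′)) (sym (++-identityʳ R)) ε

ld-step : ∀ {F F′ new} → Step1 F F′ new → LocallyDerives F F′ new
ld-step s D R = step D R s ◅ ε

ld-trans : ∀ {F F′ F″ new new′} →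
           LocallyDerives F F′ new → LocallyDerives F′ F″ new′ → LocallyDerives F F″ (new ++ new′)
ld-trans {F′ = F′} {F″} {new} {new′} p q D R =
  p D R ◅◅ subst (λ R′ → Derives (D ++ F′ ∷ R ++ new) (D ++ F″ ∷ R′))
                 (++-assoc R new new′) (q D (R ++ new))

ld-shift : ∀ xs C ys {F′ new} →
           LocallyDerives ((xs ++ C ∷ []) ++ ys) F′ new → LocallyDerives (xs ++ C ∷ ys) F′ new
ld-shift xs C ys = subst (λ G → LocallyDerives G _ _) (++-assoc xs (C ∷ []) ys)

chooseLiteral : ∀ xs ys {C L} → L ∈ C → LocallyDerives (xs ++ C ∷ ys) (xs ++ (L ∷ []) ∷ ys) []
chooseLiteral xs ys {_ ∷ []}    (here refl) = ld-refl
chooseLiteral xs ys {_ ∷ []}    (there ())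
chooseLiteral xs ys {_ ∷ _ ∷ _} L∈C         = ld-step (A1 xs ys _ _ L∈C λ ())

atomicUnit-∌-all : ∀ {P C R F} → Unit (Atomic ∩ P) C → all R F ∉ C
atomicUnit-∌-all (_ , refl , () , _) (here refl)
atomicUnit-∌-all (_ , refl , _ , _) (there ())

module ModelGuided (I : Interp) where
  open Interp I
  open Sem I

  ⟦⟧F-++ : ∀ {e} F₁ {F₂} → ⟦ F₁ ⟧F e → ⟦ F₂ ⟧F e → ⟦ F₁ ++ F₂ ⟧F e
  ⟦⟧F-++ []       _         s₂ = s₂
  ⟦⟧F-++ (_ ∷ F₁) (sC , s₁) s₂ = sC , ⟦⟧F-++ F₁ s₁ s₂

  ⟦⟧C⇒Any : ∀ {e} C → ⟦ C ⟧C e → Any (λ L → ⟦ L ⟧L e) C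
  ⟦⟧C⇒Any (_ ∷ _) (inj₁ sL) = here sL
  ⟦⟧C⇒Any (_ ∷ C) (inj₂ sC) = there (⟦⟧C⇒Any C sC)

  ⟦⟧F⇒All : ∀ {e} F → ⟦ F ⟧F e → All (Any (λ L → ⟦ L ⟧L e)) F
  ⟦⟧F⇒All []      _         = []
  ⟦⟧F⇒All (C ∷ F) (sC , sF) = ⟦⟧C⇒Any C sC ∷ ⟦⟧F⇒All F sF

  TrueAt : Δ → Lit → Set
  TrueAt d L = ⟦ L ⟧L d

  atomic-clash : ∀ {d L} → Atomic L → ⟦ L ⟧L d → ¬ ⟦ comp L ⟧L d
  atomic-clash apos sL sL̄ = sL̄ sL
  atomic-clash aneg sL sL̄ = sL sL̄

  SatBelow : ℕ → CNF → Set
  SatBelow k F = Σ Δ (λ e → ⟦ F ⟧F e) × depthF F < k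

  Solved : CNF → Set
  Solved F = Σ Δ λ d → All (Unit (Atomic ∩ TrueAt d)) F

  module _ {b : ℕ} {d : Δ} where

    Holds : Lit → Set
    Holds L = ⟦ L ⟧L d × depthL L ≤ b

    extend-holds : ∀ R F₁ L → Holds (all R F₁) → Holds L → Holds (extend R F₁ L)
    extend-holds R F₁ (ex R′ F₂) (s₁ , d₁) ((e , r , s₂) , d₂) with R ≟ R′
    ... | yes refl =
      (e , r , ⟦⟧F-++ F₁ (s₁ e r) s₂) , subst (_< b) (sym (depthF-++ F₁ F₂)) (⊔-lub d₁ d₂)
    ... | no _     = (e , r , s₂) , d₂
    extend-holds R F₁ (pos _)   _ h = h
    extend-holds R F₁ (neg _)   _ h = h
    extend-holds R F₁ (all _ _) _ h = h

    chooseLiterals : ∀ xs ys → All (Unit Holds) xs →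
                     All (Any (TrueAt d) ∩ All (λ L → depthL L ≤ b)) ys →
                     Σ CNF λ F′ → All (Unit Holds) F′ × LocallyDerives (xs ++ ys) F′ []
    chooseLiterals xs []       us []                 = xs ++ [] , ++⁺ us [] , ld-refl
    chooseLiterals xs (C ∷ ys) us ((true , shallow) ∷ rest) =
      let L , L∈C , sL = find true
          F′ , us′ , der = chooseLiterals (xs ++ (L ∷ []) ∷ []) ys
                             (++⁺ us ((L , refl , sL , All.lookup shallow L∈C) ∷ [])) rest
      in  F′ , us′ , ld-trans (chooseLiteral xs ys L∈C) (ld-shift xs (L ∷ []) ys der)

    universal⊎basicUnits : ∀ F → All (Unit Holds) F →
      (∃₂ λ R F₁ → Any (all R F₁ ∈_) F × Holds (all R F₁)) ⊎ All (Unit (Basic ∩ Holds)) F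
    universal⊎basicUnits []      []                  = inj₂ []
    universal⊎basicUnits (_ ∷ F) ((L , refl , h) ∷ us) with basic⊎universal L
    ... | inj₂ (R , F₁ , refl) = inj₁ (R , F₁ , here (here refl) , h)
    ... | inj₁ basic with universal⊎basicUnits F us
    ...   | inj₁ (R , F₁ , found , h′) = inj₁ (R , F₁ , there found , h′)
    ...   | inj₂ bs                    = inj₂ ((L , refl , basic , h) ∷ bs)

    applyA2 : ∀ R F₁ → Holds (all R F₁) → ∀ F → All (Unit Holds) F →
              Σ CNF λ F′ → A2R R F₁ F F′ × All (Unit Holds) F′
    applyA2 R F₁ h [] [] = [] , nil , []
    applyA2 R F₁ h (_ ∷ F) ((L , refl , hL) ∷ us) with applyA2 R F₁ h F us | L ≟L all R F₁
    ... | F′ , a2 , us′ | yes refl = F′ , drop (here refl) a2 , us′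
    ... | F′ , a2 , us′ | no L≢∀   =
      (extend R F₁ L ∷ []) ∷ F′ ,
      keep (λ { (here ∀≡L) → L≢∀ (sym ∀≡L) ; (there ()) }) a2 ,
      (_ , refl , extend-holds R F₁ L h hL) ∷ us′

    eliminateUniversals : ∀ n F → length F < n → All (Unit Holds) F →
      Σ CNF λ F′ → All (Unit (Basic ∩ Holds)) F′ × LocallyDerives F F′ []
    eliminateUniversals zero    F () _
    eliminateUniversals (suc n) F len<n us with universal⊎basicUnits F us
    ... | inj₂ bs = F , bs , ld-refl
    ... | inj₁ (R , F₁ , found , h) =
      let F′ , a2 , us′ = applyA2 R F₁ h F us
          F″ , bs , der = eliminateUniversals n F′
                            (<-≤-trans (A2R-length-< a2 found) (≤-pred len<n)) us′
      in  F″ , bs , ld-trans (ld-step (A2 R F₁ F F′ found a2)) der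

    spawnSuccessors : ∀ xs ys → All (Unit (Atomic ∩ TrueAt d)) xs → All (Unit (Basic ∩ Holds)) ys →
      Σ CNF λ F′ → Σ (List CNF) λ new →
        All (Unit (Atomic ∩ TrueAt d)) F′ × All (SatBelow b) new × LocallyDerives (xs ++ ys) F′ new
    spawnSuccessors xs [] as [] = xs ++ [] , [] , ++⁺ as [] , [] , ld-refl
    spawnSuccessors xs (_ ∷ ys) as ((L , refl , basic , sL , shallow) ∷ bs)
      with basic⇒atomic⊎existential basic
    ... | inj₁ atomic =
      let F′ , new , as′ , sNew , der =
            spawnSuccessors (xs ++ (L ∷ []) ∷ []) ys (++⁺ as ((L , refl , atomic , sL) ∷ [])) bs
      in  F′ , new , as′ , sNew , ld-shift xs (L ∷ []) ys der
    ... | inj₂ (R , F₁ , refl) =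
      let e , r , sF₁ = sL
          F′ , new , as′ , sNew , der = spawnSuccessors xs ys as bs
      in  F′ , F₁ ∷ new , as′ , ((e , sF₁) , shallow) ∷ sNew ,
          ld-trans (ld-step (A3 xs ys R F₁ basicUnits)) der
      where
      basicUnits : AllBasicUnits (xs ++ (ex R F₁ ∷ []) ∷ ys)
      basicUnits = ++⁺ (All.map (Unit-map (atomic⇒basic ∘ proj₁)) as)
                       ((ex R F₁ , refl , bex) ∷ All.map (Unit-map proj₁) bs)

  expand : ∀ {k} F → SatBelow (suc k) F →
    Σ CNF λ F′ → Σ (List CNF) λ new → Solved F′ × All (SatBelow k) new × LocallyDerives F F′ new
  expand {k} F ((d , sF) , depth<) =
    let F₁ , us , der₁ = chooseLiterals {k} {d} [] F []
                           (All.zip (⟦⟧F⇒All F sF , depthF≤⇒All F (≤-pred depth<)))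
        F₂ , bs , der₂ = eliminateUniversals (suc (length F₁)) F₁ ≤-refl us
        F₃ , new , as , sNew , der₃ = spawnSuccessors [] F₂ [] bs
    in  F₃ , new , (d , as) , sNew , ld-trans der₁ (ld-trans der₂ der₃)

  -- Terminates lexicographically: the depth bound k, then the queue Q of sets below k + 1.
  saturate : ∀ k D Q E → All Solved D → All (SatBelow (suc k)) Q → All (SatBelow k) E →
             Σ Family λ S → Derives (D ++ Q ++ E) S × All Solved S
  saturate k D (F ∷ Q) E sD (sF ∷ sQ) sE with expand F sF
  ... | F′ , new , solved , sNew , der =
    let S , der′ , sS = saturate k (D ++ F′ ∷ []) Q (E ++ new)
                          (++⁺ sD (solved ∷ [])) sQ (++⁺ sE sNew)
    in  S , der D (Q ++ E) ◅◅ subst (λ G → Derives G S) reassoc der′ , sS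
    where
    reassoc : (D ++ F′ ∷ []) ++ Q ++ E ++ new ≡ D ++ F′ ∷ (Q ++ E) ++ new
    reassoc = trans (++-assoc D (F′ ∷ []) (Q ++ E ++ new))
                    (cong (λ G → D ++ F′ ∷ G) (sym (++-assoc Q E new)))
  saturate (suc k) D [] E sD [] sE =
    let S , der , sS = saturate k D E [] sD sE []
    in  S , subst (λ G → Derives (D ++ G) S) (++-identityʳ E) der , sS
  saturate zero D [] [] sD [] [] = D , subst (λ G → Derives G D) (sym (++-identityʳ D)) ε , sD
  saturate zero D [] (_ ∷ _) _ [] ((_ , ()) ∷ _)

  solved⇒¬Step1 : ∀ {F F′ new} → Solved F → ¬ Step1 F F′ new
  solved⇒¬Step1 (_ , us) (A1 xs _ _ _ L∈CL CL≢L) with All.head (++⁻ʳ xs us)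
  ... | _ , refl , _ with L∈CL
  ...   | here refl = CL≢L refl
  solved⇒¬Step1 (_ , us) (A2 _ _ _ _ found _) = uncurry atomicUnit-∌-all (All.lookupAny us found)
  solved⇒¬Step1 (_ , us) (A3 xs _ _ _ _) with All.head (++⁻ʳ xs us)
  ... | _ , refl , () , _

  solved⇒complete : ∀ S → All Solved S → Complete S
  solved⇒complete S sS _ (step xs _ s) = solved⇒¬Step1 (All.head (++⁻ʳ xs sS)) s

  solved⇒clashFree : ∀ S → All Solved S → ClashFree S
  solved⇒clashFree S = All.map λ { (d , us) → noEmpty us , noClash us }
    where
    noEmpty : ∀ {d F} → All (Unit (Atomic ∩ TrueAt d)) F → [] ∉ F
    noEmpty us []∈F with All.lookup us []∈F
    ... | _ , () , _
    noClash : ∀ {d F} → All (Unit (Atomic ∩ TrueAt d)) F → ∀ L → (L ∷ []) ∈ F → (comp L ∷ []) ∉ F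
    noClash us L L∈F L̄∈F with Unit-literal (All.lookup us L∈F) | Unit-literal (All.lookup us L̄∈F)
    ... | atomic , sL | _ , sL̄ = atomic-clash atomic sL sL̄

mainTheorem4 : (F : CNF) → Satisfiable F →
    Σ Family (λ S → Derives (F ∷ []) S × Complete S × ClashFree S)
mainTheorem4 F (I , d , sF) =
  let S , der , sS = saturate (depthF F) [] (F ∷ []) [] [] (((d , sF) , ≤-refl) ∷ []) []
  in  S , der , solved⇒complete S sS , solved⇒clashFree S sS
  where open ModelGuided I
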